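{- Let $G$ be an abelian group. If a subset $C \subseteq G$ is a maximal supplement in $G$, then $C$ is solid.
   Context: For subsets of $G$, $A - B = \{a - b : a\in A, b\in B\}$. $C \subseteq G$ is a supplement for $W \subseteq G$ if the translates $c + W$, $c \in C$, are pairwise disjoint; it is a maximal supplement for $W$ if moreover no proper superset of $C$ is a supplement for $W$; $C$ is a maximal supplement in $G$ if it is a maximal supplement for some $W \subseteq G$. $C$ is solid if there is no set $D \supsetneq C$ with $D - D = C - C$. -}

module Defs where

open import Level using (Level; _⊔_; suc)
open import Algebra.Bundles using (AbelianGroup)
open import Data.Product using (Σ; _×_; ∃; _,_)
open import Relation.Nullary using (¬_)

module _ {c ℓ : Level} (G : AbelianGroup c ℓ) where
  open AbelianGroup G renaming (Carrier to |G|)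

  record Subset (p : Level) : Set (c ⊔ ℓ ⊔ suc p) where
    field
      _∋_  : |G| → Set p
      resp : ∀ {x y} → x ≈ y → _∋_ x → _∋_ y
  open Subset public

  module _ {p : Level} where
    _⊆_ : Subset p → Subset p → Set (c ⊔ p)
    A ⊆ B = ∀ x → A ∋ x → B ∋ x

    _⊋_ : Subset p → Subset p → Set (c ⊔ p)
    B ⊋ A = A ⊆ B × ∃ λ x → B ∋ x × ¬ (A ∋ x)

    _∈Diff[_,_] : |G| → Subset p → Subset p → Set (c ⊔ ℓ ⊔ p)
    x ∈Diff[ A , B ] = Σ |G| λ a → Σ |G| λ b → A ∋ a × B ∋ b × x ≈ a ∙ b ⁻¹

    SameDiffs : Subset p → Subset p → Set (c ⊔ ℓ ⊔ p)
    SameDiffs A B = ∀ x → (x ∈Diff[ A , A ] → x ∈Diff[ B , B ])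
                        × (x ∈Diff[ B , B ] → x ∈Diff[ A , A ])

    -- C is a supplement for W: the translates c ∙ W (c ∈ C) are pairwise
    -- disjoint, i.e. c ∙ w = c' + w' with c, c' ∈ C, w, w' ∈ W forces c = c'.
    IsSupplement : Subset p → Subset p → Set (c ⊔ ℓ ⊔ p)
    IsSupplement C W = ∀ a b w w' → C ∋ a → C ∋ b → W ∋ w → W ∋ w' →
                       a ∙ w ≈ b ∙ w' → a ≈ b

    IsMaximalSupplement : Subset p → Subset p → Set (c ⊔ ℓ ⊔ suc p)
    IsMaximalSupplement C W =
      IsSupplement C W × (∀ (D : Subset p) → D ⊋ C → ¬ IsSupplement D W)

    IsMaximalSupplementInG : Subset p → Set (c ⊔ ℓ ⊔ suc p)
    IsMaximalSupplementInG C = ∃ λ (W : Subset p) → IsMaximalSupplement C W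

    IsSolid : Subset p → Set (c ⊔ ℓ ⊔ suc p)
    IsSolid C = ∀ (D : Subset p) → D ⊋ C → ¬ SameDiffs D C

-- Whether C is a supplement for W depends only on C − C: the translates of W
-- by a and b meet exactly when a − b ∈ W − W.  Hence a set D ⊋ C with
-- D − D = C − C would be a strictly larger supplement for the same W,
-- contradicting maximality.
module Submission where

open import Defs
open import Level using (Level)
open import Algebra.Bundles using (AbelianGroup)
open import Data.Product using (_,_; proj₁)
import Algebra.Properties.Group as GroupProperties
import Algebra.Properties.AbelianGroup as AbelianGroupProperties
import Relation.Binary.Reasoning.Setoid as SetoidReasoning

module _ {c ℓ : Level} (G : AbelianGroup c ℓ) where
  open AbelianGroup G
  open GroupProperties group using (//-rightDividesˡ; //-rightDividesʳ; x∙y⁻¹≈ε⇒x≈y; x≈y⇒x∙y⁻¹≈ε)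
  open AbelianGroupProperties G using (xyx⁻¹≈y)
  open SetoidReasoning setoid

  x∙y≈u∙v⇒x∙u⁻¹≈v∙y⁻¹ : ∀ x y u v → x ∙ y ≈ u ∙ v → x ∙ u ⁻¹ ≈ v ∙ y ⁻¹
  x∙y≈u∙v⇒x∙u⁻¹≈v∙y⁻¹ x y u v eq = begin
    x ∙ u ⁻¹                ≈⟨ ∙-congʳ (//-rightDividesʳ y x) ⟨
    (x ∙ y ∙ y ⁻¹) ∙ u ⁻¹   ≈⟨ ∙-congʳ (∙-congʳ eq) ⟩
    (u ∙ v ∙ y ⁻¹) ∙ u ⁻¹   ≈⟨ ∙-congʳ (assoc u v (y ⁻¹)) ⟩
    (u ∙ (v ∙ y ⁻¹)) ∙ u ⁻¹ ≈⟨ xyx⁻¹≈y u (v ∙ y ⁻¹) ⟩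
    v ∙ y ⁻¹                ∎

  x∙u⁻¹≈v∙y⁻¹⇒x∙y≈u∙v : ∀ x y u v → x ∙ u ⁻¹ ≈ v ∙ y ⁻¹ → x ∙ y ≈ u ∙ v
  x∙u⁻¹≈v∙y⁻¹⇒x∙y≈u∙v x y u v eq = begin
    x ∙ y                ≈⟨ ∙-congʳ (//-rightDividesˡ u x) ⟨
    (x ∙ u ⁻¹ ∙ u) ∙ y   ≈⟨ ∙-congʳ (∙-congʳ eq) ⟩
    (v ∙ y ⁻¹ ∙ u) ∙ y   ≈⟨ ∙-congʳ (comm (v ∙ y ⁻¹) u) ⟩
    (u ∙ (v ∙ y ⁻¹)) ∙ y ≈⟨ assoc u (v ∙ y ⁻¹) y ⟩
    u ∙ ((v ∙ y ⁻¹) ∙ y) ≈⟨ ∙-congˡ (//-rightDividesˡ y v) ⟩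
    u ∙ v                ∎

  module _ {p : Level} where

    IsSupplement-antitoneDiffs : ∀ (C D W : Subset G p) →
      (∀ x → _∈Diff[_,_] G x D D → _∈Diff[_,_] G x C C) →
      IsSupplement G C W → IsSupplement G D W
    IsSupplement-antitoneDiffs C D W D-D⊆C-C supC a b w w' Da Db Ww Ww' aw≈bw'
      with D-D⊆C-C (a ∙ b ⁻¹) (a , b , Da , Db , refl)
    ... | c₁ , c₂ , Cc₁ , Cc₂ , a-b≈c₁-c₂ =
      x∙y⁻¹≈ε⇒x≈y a b (trans a-b≈c₁-c₂ (x≈y⇒x∙y⁻¹≈ε c₁≈c₂))
      where
      c₁-c₂≈w'-w : c₁ ∙ c₂ ⁻¹ ≈ w' ∙ w ⁻¹
      c₁-c₂≈w'-w = trans (sym a-b≈c₁-c₂) (x∙y≈u∙v⇒x∙u⁻¹≈v∙y⁻¹ a w b w' aw≈bw')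

      c₁≈c₂ : c₁ ≈ c₂
      c₁≈c₂ = supC c₁ c₂ w w' Cc₁ Cc₂ Ww Ww'
                (x∙u⁻¹≈v∙y⁻¹⇒x∙y≈u∙v c₁ w c₂ w' c₁-c₂≈w'-w)

proposition5p1 : ∀ {c ℓ p : Level} (G : AbelianGroup c ℓ) (C : Subset G p) →
    IsMaximalSupplementInG G C → IsSolid G C
proposition5p1 G C (W , supC , maxC) D D⊋C sameDiffs =
  maxC D D⊋C (IsSupplement-antitoneDiffs G C D W (λ x → proj₁ (sameDiffs x)) supC)
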